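{- Let $c \geq 2$ and $n \geq 3$ be integers. Every collection of directed graphs $G_1, \ldots, G_c$ on a common set of $n$ vertices containing no rainbow $S_{1,1}$ satisfies \[\sum_{i=1}^c e(G_i) \leq \begin{cases} n^2-n & \text{if } c \leq 3,\\ c\left\lfloor\frac{n^2}{4}\right\rfloor & \text{if } c \geq 4. \end{cases} \] Moreover, these bounds are sharp: for all such $c,n$ there is a collection with no rainbow $S_{1,1}$ attaining equality.
   Context: Each $G_i$ is a directed graph without loops or multiple edges on the common vertex set $V$ (for distinct $u,v$, the edges $uv$ and $vu$ may both be present); $e(G_i)$ denotes the number of directed edges of $G_i$. Think of $G_i$ as the edges of color $i$. $S_{1,1}$ is the directed path with two edges $x\to y\to z$ on three distinct vertices. The collection contains a rainbow $S_{1,1}$ if there are distinct vertices $x,y,z\in V$ and distinct indices $i\neq j$ with $xy\in E(G_i)$ and $yz\in E(G_j)$. -}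

module Defs where

open import Data.Nat using (ℕ; zero; suc; _+_; _*_; _∸_; _≤_; _≤ᵇ_)
open import Data.Nat.DivMod using (_/_)
open import Data.Bool using (Bool; true; false; if_then_else_)
open import Data.Fin using (Fin)
open import Data.Product using (∃-syntax; _×_)
open import Relation.Binary.PropositionalEquality using (_≡_; _≢_)

sumFin : (k : ℕ) → (Fin k → ℕ) → ℕ
sumFin zero    f = 0
sumFin (suc k) f = f Fin.zero + sumFin k (λ i → f (Fin.suc i))

-- A directed graph on vertex set Fin n: adjacency predicate (u→v edge iff true).
-- Loopless: no edge v→v. Multiple edges are impossible by construction;
-- both u→v and v→u may be present.
Digraph : ℕ → Set
Digraph n = Fin n → Fin n → Bool

Loopless : {n : ℕ} → Digraph n → Set
Loopless {n} G = (v : Fin n) → G v v ≡ false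

toℕᵇ : Bool → ℕ
toℕᵇ true  = 1
toℕᵇ false = 0

edges : {n : ℕ} → Digraph n → ℕ
edges {n} G = sumFin n (λ u → sumFin n (λ v → toℕᵇ (G u v)))

Collection : ℕ → ℕ → Set
Collection c n = Fin c → Digraph n

totalEdges : {c n : ℕ} → Collection c n → ℕ
totalEdges {c} G = sumFin c (λ i → edges (G i))

RainbowS11 : {c n : ℕ} → Collection c n → Set
RainbowS11 {c} {n} G =
  ∃[ x ] ∃[ y ] ∃[ z ] ∃[ i ] ∃[ j ]
    (x ≢ y × y ≢ z × x ≢ z × i ≢ j × G i x y ≡ true × G j y z ≡ true)

bound : ℕ → ℕ → ℕ
bound c n = if c ≤ᵇ 3 then n * n ∸ n else c * (n * n / 4)

module Submission where

open import Defs
open import Data.Bool using (Bool; true; false; not; _∧_)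
open import Data.Bool.Properties using (∧-comm; ∧-conicalˡ; ∧-conicalʳ; ∧-inverseʳ; not-injective)
open import Data.Empty using (⊥)
open import Data.Fin using (Fin; zero; suc; toℕ; _≟_; punchIn; punchOut)
open import Data.Fin.Properties using (punchInᵢ≢i; punchIn-punchOut; any?)
open import Data.Nat hiding (_≟_)
open import Data.Nat using () renaming (_≟_ to _≟ℕ_)
open import Data.Nat.DivMod using (_/_; /-congˡ; m*n/n≡m; m/n≤m; +-distrib-/-∣ʳ)
open import Data.Nat.Divisibility using (divides-refl)
open import Data.Nat.Properties hiding (_≟_)
open import Algebra.Properties.Semiring.Sum +-*-semiring
  using (sum; sum-remove; ∑-distrib-+; ∑-comm; sum-cong-≗; *-distribˡ-sum)
open import Data.Nat.Tactic.RingSolver using (solve-∀)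
open import Data.Product using (Σ-syntax; ∃-syntax; _×_; _,_; proj₁; proj₂)
open import Data.Sum using (_⊎_; inj₁; inj₂)
open import Function using (_∘_)
open import Relation.Binary.PropositionalEquality
open import Relation.Nullary using (¬_; yes; no; does; contradiction)
open import Relation.Nullary.Decidable using (dec-true; _×-dec_)

-- Call an ordered pair heavy if at least two colours contain the edge u → v. Without a rainbow
-- S₁,₁ every edge x → v with v ≠ p has the colour of any edge p → x; hence a heavy edge u → p
-- admits no edge into u except from p and no edge out of p except to u. Split the vertices into
-- X (tail but not head of a heavy edge), Y (head only), Z (both) and W (neither), of sizes
-- x, y, z, w. These constraints bound the degree of every vertex by c·y + w on X, c·x + w on Y
-- (plus 1 each if x = y = 1), 2c on Z and x + y + 2w − 2 on W. Summing, the number of edges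
-- T satisfies T + w ≤ c·x·y + w(x + y) + c·z + w² (+ 1 if x = y = 1). With n = x + y + z + w,
-- z ≠ 1 and, for n = 3, z ≠ 3 (both because heavy edges at Z-vertices come in 2-cycles), this
-- polynomial is at most n² − n for c ≤ 3 and c⌊n²/4⌋ for c ≥ 4. Equality is attained by the
-- complete digraph in one colour, respectively by every colour carrying all edges from a
-- ⌊n/2⌋-set to its complement.

-- Finite sums and counting

sumFin≡sum : ∀ k (f : Fin k → ℕ) → sumFin k f ≡ sum f
sumFin≡sum zero    f = refl
sumFin≡sum (suc k) f = cong (f zero +_) (sumFin≡sum k (λ i → f (suc i)))

sumFin-cong : ∀ k {f g : Fin k → ℕ} → (∀ i → f i ≡ g i) → sumFin k f ≡ sumFin k g
sumFin-cong k {f} {g} f≗g =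
  trans (sumFin≡sum k f) (trans (sum-cong-≗ f≗g) (sym (sumFin≡sum k g)))

sumFin-distrib-+ : ∀ k (f g : Fin k → ℕ) →
  sumFin k (λ i → f i + g i) ≡ sumFin k f + sumFin k g
sumFin-distrib-+ k f g = begin
  sumFin k (λ i → f i + g i) ≡⟨ sumFin≡sum k _ ⟩
  sum (λ i → f i + g i)      ≡⟨ ∑-distrib-+ f g ⟩
  sum f + sum g              ≡⟨ cong₂ _+_ (sumFin≡sum k f) (sumFin≡sum k g) ⟨
  sumFin k f + sumFin k g    ∎
  where open ≡-Reasoning

sumFin-comm : ∀ a b (f : Fin a → Fin b → ℕ) →
  sumFin a (λ i → sumFin b (f i)) ≡ sumFin b (λ j → sumFin a (λ i → f i j))
sumFin-comm a b f = begin
  sumFin a (λ i → sumFin b (f i))         ≡⟨ sumFin-cong a (λ i → sumFin≡sum b (f i)) ⟩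
  sumFin a (λ i → sum (f i))              ≡⟨ sumFin≡sum a _ ⟩
  sum (λ i → sum (f i))                   ≡⟨ ∑-comm f ⟩
  sum (λ j → sum (λ i → f i j))           ≡⟨ sumFin≡sum b _ ⟨
  sumFin b (λ j → sum (λ i → f i j))      ≡⟨ sumFin-cong b (λ j → sumFin≡sum a (λ i → f i j)) ⟨
  sumFin b (λ j → sumFin a (λ i → f i j)) ∎
  where open ≡-Reasoning

sumFin-*ˡ : ∀ k a (f : Fin k → ℕ) → sumFin k (λ i → a * f i) ≡ a * sumFin k f
sumFin-*ˡ k a f = begin
  sumFin k (λ i → a * f i) ≡⟨ sumFin≡sum k _ ⟩
  sum (λ i → a * f i)      ≡⟨ *-distribˡ-sum a f ⟨
  a * sum f                ≡⟨ cong (a *_) (sumFin≡sum k f) ⟨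
  a * sumFin k f           ∎
  where open ≡-Reasoning

sumFin-*ʳ : ∀ k a (f : Fin k → ℕ) → sumFin k (λ i → f i * a) ≡ sumFin k f * a
sumFin-*ʳ k a f = trans (sumFin-cong k (λ i → *-comm (f i) a))
                        (trans (sumFin-*ˡ k a f) (*-comm a (sumFin k f)))

sumFin-const : ∀ k a → sumFin k (λ _ → a) ≡ k * a
sumFin-const zero    a = refl
sumFin-const (suc k) a = cong (a +_) (sumFin-const k a)

sumFin-mono-≤ : ∀ k {f g : Fin k → ℕ} → (∀ i → f i ≤ g i) → sumFin k f ≤ sumFin k g
sumFin-mono-≤ zero    f≤g = z≤n
sumFin-mono-≤ (suc k) f≤g = +-mono-≤ (f≤g zero) (sumFin-mono-≤ k (λ i → f≤g (suc i)))

sumFin-remove : ∀ k (f : Fin (suc k) → ℕ) a →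
  sumFin (suc k) f ≡ f a + sumFin k (f ∘ punchIn a)
sumFin-remove k f a = begin
  sumFin (suc k) f                ≡⟨ sumFin≡sum (suc k) f ⟩
  sum f                           ≡⟨ sum-remove f ⟩
  f a + sum (f ∘ punchIn a)       ≡⟨ cong (f a +_) (sumFin≡sum k _) ⟨
  f a + sumFin k (f ∘ punchIn a)  ∎
  where open ≡-Reasoning

term≤sumFin : ∀ k (f : Fin k → ℕ) a → f a ≤ sumFin k f
term≤sumFin (suc k) f a = ≤-trans (m≤m+n (f a) _) (≤-reflexive (sym (sumFin-remove k f a)))

two-terms≤sumFin : ∀ k (f : Fin k → ℕ) {a b} → a ≢ b → f a + f b ≤ sumFin k f
two-terms≤sumFin (suc k) f {a} {b} a≢b = begin
  f a + f b                            ≡⟨ cong (λ i → f a + f i) (punchIn-punchOut a≢b) ⟨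
  f a + f (punchIn a (punchOut a≢b))   ≤⟨ +-monoʳ-≤ (f a) (term≤sumFin k (f ∘ punchIn a) _) ⟩
  f a + sumFin k (f ∘ punchIn a)       ≡⟨ sumFin-remove k f a ⟨
  sumFin (suc k) f                     ∎
  where open ≤-Reasoning

sumFin-single : ∀ k (f : Fin k → ℕ) a → (∀ b → b ≢ a → f b ≡ 0) → sumFin k f ≡ f a
sumFin-single (suc k) f a f≡0 = begin
  sumFin (suc k) f               ≡⟨ sumFin-remove k f a ⟩
  f a + sumFin k (f ∘ punchIn a) ≡⟨ cong (f a +_) (sumFin-cong k (λ j → f≡0 _ (punchInᵢ≢i a j))) ⟩
  f a + sumFin k (λ _ → 0)       ≡⟨ cong (f a +_) (trans (sumFin-const k 0) (*-zeroʳ k)) ⟩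
  f a + 0                        ≡⟨ +-identityʳ (f a) ⟩
  f a                            ∎
  where open ≡-Reasoning

sumFin-mono-except : ∀ k (f g : Fin k → ℕ) a → (∀ b → b ≢ a → f b ≤ g b) →
  sumFin k f + g a ≤ sumFin k g + f a
sumFin-mono-except (suc k) f g a f≤g = begin
  sumFin (suc k) f + g a                 ≡⟨ cong (_+ g a) (sumFin-remove k f a) ⟩
  f a + sumFin k (f ∘ punchIn a) + g a   ≤⟨ +-monoˡ-≤ (g a) (+-monoʳ-≤ (f a) rest≤) ⟩
  f a + sumFin k (g ∘ punchIn a) + g a   ≡⟨ swap (f a) _ (g a) ⟩
  g a + sumFin k (g ∘ punchIn a) + f a   ≡⟨ cong (_+ f a) (sumFin-remove k g a) ⟨
  sumFin (suc k) g + f a                 ∎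
  where
  open ≤-Reasoning
  rest≤ : sumFin k (f ∘ punchIn a) ≤ sumFin k (g ∘ punchIn a)
  rest≤ = sumFin-mono-≤ k (λ j → f≤g _ (punchInᵢ≢i a j))
  swap : ∀ a s b → a + s + b ≡ b + s + a
  swap = solve-∀

sumFin-pos : ∀ k (f : Fin k → ℕ) → 0 < sumFin k f → ∃[ a ] 0 < f a
sumFin-pos (suc k) f pos with f zero in f0≡
... | suc _ = zero , subst (0 <_) (sym f0≡) (s≤s z≤n)
... | zero  with sumFin-pos k (f ∘ suc) pos
...   | a , fa>0 = suc a , fa>0

count : ∀ {k} → (Fin k → Bool) → ℕ
count {k} P = sumFin k (toℕᵇ ∘ P)

toℕᵇ≤1 : ∀ b → toℕᵇ b ≤ 1
toℕᵇ≤1 true  = s≤s z≤n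
toℕᵇ≤1 false = z≤n

toℕᵇ>0 : ∀ {b} → 0 < toℕᵇ b → b ≡ true
toℕᵇ>0 {true} _ = refl

count-pos : ∀ {k} (P : Fin k → Bool) {a} → P a ≡ true → 1 ≤ count P
count-pos {k} P {a} Pa = subst (λ b → toℕᵇ b ≤ count P) Pa (term≤sumFin k (toℕᵇ ∘ P) a)

count-pos⇒∃ : ∀ {k} (P : Fin k → Bool) → 1 ≤ count P → ∃[ a ] P a ≡ true
count-pos⇒∃ {k} P pos with sumFin-pos k (toℕᵇ ∘ P) pos
... | a , Pa>0 = a , toℕᵇ>0 Pa>0

count≡1⇒unique : ∀ {k} (P : Fin k → Bool) {a b} → count P ≡ 1 → P a ≡ true → P b ≡ true → a ≡ b
count≡1⇒unique {k} P {a} {b} #P≡1 Pa Pb with a ≟ b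
... | yes a≡b = a≡b
... | no  a≢b = contradiction (≤-trans two≤#P (≤-reflexive #P≡1)) (<-irrefl refl)
  where
  two≤#P : 2 ≤ count P
  two≤#P = subst₂ (λ s t → toℕᵇ s + toℕᵇ t ≤ count P) Pa Pb (two-terms≤sumFin k (toℕᵇ ∘ P) a≢b)

count-single : ∀ {k} (P : Fin k → Bool) {a} → P a ≡ true → (∀ b → P b ≡ true → b ≡ a) → count P ≡ 1
count-single {k} P {a} Pa only-a = trans (sumFin-single k (toℕᵇ ∘ P) a others≡0) (cong toℕᵇ Pa)
  where
  others≡0 : ∀ b → b ≢ a → toℕᵇ (P b) ≡ 0
  others≡0 b b≢a with P b in Pb
  ... | true  = contradiction (only-a b Pb) b≢a
  ... | false = refl

count≡k⇒all : ∀ {k} (P : Fin k → Bool) → count P ≡ k → ∀ a → P a ≡ true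
count≡k⇒all {k} P #P≡k a with P a in Pa
... | true  = refl
... | false = contradiction (+-cancelˡ-≤ k 1 0 k+1≤k+0) λ ()
  where
  k+1≤k+0 : k + 1 ≤ k + 0
  k+1≤k+0 = begin
    k + 1                           ≡⟨ cong (_+ 1) #P≡k ⟨
    count P + 1                     ≤⟨ sumFin-mono-except k (toℕᵇ ∘ P) (λ _ → 1) a (λ b _ → toℕᵇ≤1 (P b)) ⟩
    sumFin k (λ _ → 1) + toℕᵇ (P a) ≡⟨ cong₂ _+_ (trans (sumFin-const k 1) (*-identityʳ k)) (cong toℕᵇ Pa) ⟩
    k + 0                           ∎
    where open ≤-Reasoning

count-not : ∀ {k} (P : Fin k → Bool) → count (not ∘ P) ≡ k ∸ count P
count-not {k} P = begin
  count (not ∘ P)                                ≡⟨ m+n∸n≡m _ (count P) ⟨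
  count (not ∘ P) + count P ∸ count P            ≡⟨ cong (_∸ count P) (sumFin-distrib-+ k _ _) ⟨
  sumFin k (λ i → toℕᵇ (not (P i)) + toℕᵇ (P i)) ∸ count P ≡⟨ cong (_∸ count P) (sumFin-cong k (not+id ∘ P)) ⟩
  sumFin k (λ _ → 1) ∸ count P                   ≡⟨ cong (_∸ count P) (trans (sumFin-const k 1) (*-identityʳ k)) ⟩
  k ∸ count P                                    ∎
  where
  open ≡-Reasoning
  not+id : ∀ b → toℕᵇ (not b) + toℕᵇ b ≡ 1
  not+id true  = refl
  not+id false = refl

sumFin-by-classes : ∀ k (p q : Fin k → Bool) (F : Bool → Bool → ℕ) →
  sumFin k (λ i → F (p i) (q i)) ≡
    count (λ i → p i ∧ not (q i)) * F true false + count (λ i → not (p i) ∧ q i) * F false true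
    + count (λ i → p i ∧ q i) * F true true + count (λ i → not (p i) ∧ not (q i)) * F false false
sumFin-by-classes k p q F = trans (sumFin-cong k (λ i → split (p i) (q i))) (linear A B C D)
  where
  A B C D : Fin k → ℕ
  A i = toℕᵇ (p i ∧ not (q i))
  B i = toℕᵇ (not (p i) ∧ q i)
  C i = toℕᵇ (p i ∧ q i)
  D i = toℕᵇ (not (p i) ∧ not (q i))
  split : ∀ s t → F s t ≡ toℕᵇ (s ∧ not t) * F true false + toℕᵇ (not s ∧ t) * F false true
                          + toℕᵇ (s ∧ t) * F true true + toℕᵇ (not s ∧ not t) * F false false
  split true  true  = sym (trans (+-identityʳ _) (+-identityʳ _))
  split true  false = sym (trans (+-identityʳ _) (trans (+-identityʳ _) (trans (+-identityʳ _) (+-identityʳ _))))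
  split false true  = sym (trans (+-identityʳ _) (trans (+-identityʳ _) (+-identityʳ _)))
  split false false = sym (+-identityʳ _)
  linear : ∀ (A B C D : Fin k → ℕ) →
    sumFin k (λ i → A i * F true false + B i * F false true + C i * F true true + D i * F false false)
    ≡ sumFin k A * F true false + sumFin k B * F false true + sumFin k C * F true true + sumFin k D * F false false
  linear A B C D = trans (sumFin-distrib-+ k _ _) (cong₂ _+_
    (trans (sumFin-distrib-+ k _ _) (cong₂ _+_
      (trans (sumFin-distrib-+ k _ _) (cong₂ _+_ (sumFin-*ʳ k _ A) (sumFin-*ʳ k _ B)))
      (sumFin-*ʳ k _ C)))
    (sumFin-*ʳ k _ D))

-- The arithmetic of the degree budget

-- The degree bounds of X- and Y-vertices exceed c·y + w and c·x + w by one only when x = y = 1.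
bonus : ℕ → ℕ → ℕ
bonus 1 1 = 1
bonus _ _ = 0

bonus≡0 : ∀ x y → ¬ (x ≡ 1 × y ≡ 1) → bonus x y ≡ 0
bonus≡0 0             _             _   = refl
bonus≡0 1             0             _   = refl
bonus≡0 1             1             ¬11 = contradiction (refl , refl) ¬11
bonus≡0 1             (suc (suc _)) _   = refl
bonus≡0 (suc (suc _)) _             _   = refl

bonus-comm : ∀ x y → bonus x y ≡ bonus y x
bonus-comm x y with x ≟ℕ 1 | y ≟ℕ 1
... | yes refl | yes refl = refl
... | no  x≢1  | _        = trans (bonus≡0 x y (x≢1 ∘ proj₁)) (sym (bonus≡0 y x (x≢1 ∘ proj₂)))
... | yes _    | no  y≢1  = trans (bonus≡0 x y (y≢1 ∘ proj₂)) (sym (bonus≡0 y x (y≢1 ∘ proj₁)))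

bonus-weight : ∀ x y → (x + y) * bonus x y ≡ 2 * bonus x y
bonus-weight x y with x ≟ℕ 1 | y ≟ℕ 1
... | yes refl | yes refl = refl
... | no  x≢1  | _        = subst (λ b → (x + y) * b ≡ 2 * b) (sym (bonus≡0 x y (x≢1 ∘ proj₁))) (*-zeroʳ (x + y))
... | yes _    | no  y≢1  = subst (λ b → (x + y) * b ≡ 2 * b) (sym (bonus≡0 x y (y≢1 ∘ proj₂))) (*-zeroʳ (x + y))

-- Half the sum of the degree bounds over all vertices; it bounds T + w for T edges.
budget : ℕ → ℕ → ℕ → ℕ → ℕ → ℕ
budget c x y z w = c * (x * y) + bonus x y + w * (x + y) + c * z + w * w

≤-by-slack : ∀ {a b} k → a + k ≡ b → a ≤ b
≤-by-slack {a} k a+k≡b = subst (a ≤_) a+k≡b (m≤m+n a k)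

≤-by-balance : ∀ {l r a k} → l + k ≡ r + a → a ≤ k → l ≤ r
≤-by-balance {l} {r} {a} {k} balance a≤k = +-cancelʳ-≤ a l r (begin
  l + a ≤⟨ +-monoʳ-≤ l a≤k ⟩
  l + k ≡⟨ balance ⟩
  r + a ∎)
  where open ≤-Reasoning

+≤* : ∀ {a b} → 2 ≤ a → 2 ≤ b → a + b ≤ a * b
+≤* {suc (suc a)} {suc (suc b)} (s≤s (s≤s _)) (s≤s (s≤s _)) = ≤-by-slack (a + b + a * b) (expand a b)
  where
  expand : ∀ a b → 2 + a + (2 + b) + (a + b + a * b) ≡ (2 + a) * (2 + b)
  expand = solve-∀

sum-of-squares-≤ : ∀ x y → x ≤ y → x * x + y * y ≡ 2 * (x * y) + ∣ x - y ∣ * ∣ x - y ∣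
sum-of-squares-≤ x y x≤y with y ∸ x | m+[n∸m]≡n x≤y
... | d | refl = trans (expand x d) (cong (λ e → 2 * (x * (x + d)) + e * e) (sym (∣m-m+n∣≡n x d)))
  where
  expand : ∀ x d → x * x + (x + d) * (x + d) ≡ 2 * (x * (x + d)) + d * d
  expand = solve-∀

sum-of-squares : ∀ x y → x * x + y * y ≡ 2 * (x * y) + ∣ x - y ∣ * ∣ x - y ∣
sum-of-squares x y with ≤-total x y
... | inj₁ x≤y = sum-of-squares-≤ x y x≤y
... | inj₂ y≤x = begin
  x * x + y * y                       ≡⟨ +-comm (x * x) (y * y) ⟩
  y * y + x * x                       ≡⟨ sum-of-squares-≤ y x y≤x ⟩
  2 * (y * x) + ∣ y - x ∣ * ∣ y - x ∣ ≡⟨ cong₂ (λ p d → 2 * p + d * d) (*-comm y x) (∣-∣-comm y x) ⟩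
  2 * (x * y) + ∣ x - y ∣ * ∣ x - y ∣ ∎
  where open ≡-Reasoning

square-of-sum : ∀ x y → (x + y) * (x + y) ≡ 4 * (x * y) + ∣ x - y ∣ * ∣ x - y ∣
square-of-sum x y = begin
  (x + y) * (x + y)                         ≡⟨ expand x y ⟩
  x * x + y * y + 2 * (x * y)               ≡⟨ cong (_+ 2 * (x * y)) (sum-of-squares x y) ⟩
  2 * (x * y) + d * d + 2 * (x * y)         ≡⟨ collect (x * y) (d * d) ⟩
  4 * (x * y) + d * d                       ∎
  where
  open ≡-Reasoning
  d : ℕ
  d = ∣ x - y ∣
  expand : ∀ x y → (x + y) * (x + y) ≡ x * x + y * y + 2 * (x * y)
  expand = solve-∀
  collect : ∀ p e → 2 * p + e + 2 * p ≡ 4 * p + e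
  collect = solve-∀

amgm : ∀ x y → 4 * (x * y) ≤ (x + y) * (x + y)
amgm x y = ≤-by-slack _ (sym (square-of-sum x y))

amgm-strict : ∀ {x y} → x ≢ y → 4 * (x * y) + 1 ≤ (x + y) * (x + y)
amgm-strict {x} {y} x≢y with ∣ x - y ∣ in d≡ | square-of-sum x y
... | zero  | _  = contradiction (∣m-n∣≡0⇒m≡n d≡) x≢y
... | suc d | eq = ≤-by-slack (d + d * suc d) (trans (+-assoc (4 * (x * y)) 1 _) (sym eq))

product+sum≤sum-of-squares : ∀ x y → ¬ (x ≡ 1 × y ≡ 1) → x * y + x + y ≤ x * x + y * y
product+sum≤sum-of-squares 0       0 _ = z≤n
product+sum≤sum-of-squares 0       (suc y) _ = ≤-by-slack (y + y * y) (balance y)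
  where
  balance : ∀ y → 0 * suc y + 0 + suc y + (y + y * y) ≡ 0 * 0 + suc y * suc y
  balance = solve-∀
product+sum≤sum-of-squares (suc x) 0 _ = ≤-by-slack (x + x * x) (balance x)
  where
  balance : ∀ x → suc x * 0 + suc x + 0 + (x + x * x) ≡ suc x * suc x + 0 * 0
  balance = solve-∀
product+sum≤sum-of-squares 1 1 ¬11 = contradiction (refl , refl) ¬11
product+sum≤sum-of-squares 1 (suc (suc y)) _ = ≤-by-slack (2 * y + y * y) (balance y)
  where
  balance : ∀ y → 1 * (2 + y) + 1 + (2 + y) + (2 * y + y * y) ≡ 1 * 1 + (2 + y) * (2 + y)
  balance = solve-∀
product+sum≤sum-of-squares (suc (suc x)) 1 _ = ≤-by-slack (2 * x + x * x) (balance x)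
  where
  balance : ∀ x → (2 + x) * 1 + (2 + x) + 1 + (2 * x + x * x) ≡ (2 + x) * (2 + x) + 1 * 1
  balance = solve-∀
product+sum≤sum-of-squares a@(suc (suc _)) b@(suc (suc _)) _ = begin
  a * b + a + b                       ≡⟨ +-assoc (a * b) a b ⟩
  a * b + (a + b)                     ≤⟨ +-monoʳ-≤ (a * b) (+≤* (s≤s (s≤s z≤n)) (s≤s (s≤s z≤n))) ⟩
  a * b + a * b                       ≡⟨ cong (a * b +_) (+-identityʳ (a * b)) ⟨
  2 * (a * b)                         ≤⟨ m≤m+n _ _ ⟩
  2 * (a * b) + ∣ a - b ∣ * ∣ a - b ∣ ≡⟨ sum-of-squares a b ⟨
  a * a + b * b                       ∎
  where open ≤-Reasoning

4≤z+2*a : ∀ a z → 3 ≤ a + z → (a + z ≡ 3 → z ≢ 3) → 4 ≤ z + 2 * a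
4≤z+2*a zero    1                         (s≤s ())       _
4≤z+2*a zero    2                         (s≤s (s≤s ())) _
4≤z+2*a zero    3                         _              z≢3 = contradiction refl (z≢3 refl)
4≤z+2*a zero    (suc (suc (suc (suc z)))) _              _   = ≤-trans (s≤s (s≤s (s≤s (s≤s z≤n)))) (m≤m+n _ 0)
4≤z+2*a (suc a) z                         n≥3            _   = ≤-trans (+-monoˡ-≤ 1 n≥3) (≤-by-slack a (rearrange a z))
  where
  rearrange : ∀ a z → suc a + z + 1 + a ≡ z + 2 * suc a
  rearrange = solve-∀

4≤z+2*[x+y+w] : ∀ x y z w → 3 ≤ x + y + z + w → (x + y + z + w ≡ 3 → z ≢ 3) → 4 ≤ z + 2 * (x + y + w)
4≤z+2*[x+y+w] x y z w n≥3 z≢3 = 4≤z+2*a (x + y + w) z (subst (3 ≤_) (rearrange x y z w) n≥3) (z≢3 ∘ trans (rearrange x y z w))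
  where
  rearrange : ∀ x y z w → x + y + z + w ≡ x + y + w + z
  rearrange = solve-∀

small-budget≤square-diagonal : ∀ z w → 3 ≤ 2 + z + w → z ≢ 1 →
  budget 3 1 1 z w + (2 + z) ≤ (2 + z + w) * (2 + z + w)
small-budget≤square-diagonal z (suc w) _ _ = ≤-by-slack (z * z + 2 * z + 2 * w + 2 * z * w) (balance z w)
  where
  balance : ∀ z w → 3 + 1 + (1 + w) * 2 + 3 * z + (1 + w) * (1 + w) + (2 + z) + (z * z + 2 * z + 2 * w + 2 * z * w)
                    ≡ (2 + z + (1 + w)) * (2 + z + (1 + w))
  balance = solve-∀
small-budget≤square-diagonal (suc (suc z)) zero _ _ = ≤-by-slack (2 + 4 * z + z * z) (balance z)
  where
  balance : ∀ z → 3 + 1 + 0 + 3 * (2 + z) + 0 + (2 + (2 + z)) + (2 + 4 * z + z * z) ≡ (2 + (2 + z) + 0) * (2 + (2 + z) + 0)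
  balance = solve-∀
small-budget≤square-diagonal 1 zero _ z≢1 = contradiction refl z≢1
small-budget≤square-diagonal 0 zero (s≤s (s≤s ())) _

small-budget≤square : ∀ x y z w → 4 ≤ z + 2 * (x + y + w) → 3 ≤ x + y + z + w → z ≢ 1 →
  budget 3 x y z w + (x + y + z) ≤ (x + y + z + w) * (x + y + z + w)
small-budget≤square x y z w roomy n≥3 z≢1 with (x ≟ℕ 1) ×-dec (y ≟ℕ 1)
... | no ¬11 = ≤-by-balance (balance x y z w (bonus x y)) (begin
  bonus x y + (x * y + x + y) + z * 4   ≡⟨ cong (λ b → b + (x * y + x + y) + z * 4) (bonus≡0 x y ¬11) ⟩
  x * y + x + y + z * 4                 ≤⟨ +-mono-≤ (product+sum≤sum-of-squares x y ¬11) (*-monoʳ-≤ z roomy) ⟩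
  x * x + y * y + z * (z + 2 * (x + y + w))               ≤⟨ m≤m+n _ _ ⟩
  x * x + y * y + z * (z + 2 * (x + y + w)) + w * (x + y) ∎)
  where
  open ≤-Reasoning
  balance : ∀ x y z w b →
    3 * (x * y) + b + w * (x + y) + 3 * z + w * w + (x + y + z)
      + (x * x + y * y + z * (z + 2 * (x + y + w)) + w * (x + y))
    ≡ (x + y + z + w) * (x + y + z + w) + (b + (x * y + x + y) + z * 4)
  balance = solve-∀
... | yes (refl , refl) = small-budget≤square-diagonal z w n≥3 z≢1

Odd : ℕ → Set
Odd n = ∃[ q ] n ≡ suc (2 * q)

even-or-odd : ∀ n → ∃[ q ] n ≡ 2 * q ⊎ Odd n
even-or-odd zero = inj₁ (0 , refl)
even-or-odd (suc n) with even-or-odd n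
... | inj₁ (q , refl) = inj₂ (q , refl)
... | inj₂ (q , refl) = inj₁ (suc q , cong suc (sym (+-suc q (q + 0))))

z-piece-strict : ∀ z a → 1 ≤ z → 5 ≤ z + 2 * a → z * 4 + 1 ≤ z * (z + 2 * a)
z-piece-strict (suc z) a _ roomy = ≤-trans (≤-by-slack z (rearrange z)) (*-monoʳ-≤ (suc z) roomy)
  where
  rearrange : ∀ z → suc z * 4 + 1 + z ≡ suc z * 5
  rearrange = solve-∀

w-piece : ∀ d s w e → e ≤ 1 → e ≤ w →
  4 * (w * s) + 4 * (w * w) + (4 + d) * e ≤ (4 + d) * (w * w) + 2 * (4 + d) * (s * w) + 4 * w
w-piece d s w 0 _ _ =
  ≤-by-slack (d * (w * w) + (4 + 2 * d) * (s * w) + 4 * w) (balance d s w)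
  where
  balance : ∀ d s w → 4 * (w * s) + 4 * (w * w) + (4 + d) * 0 + (d * (w * w) + (4 + 2 * d) * (s * w) + 4 * w)
                      ≡ (4 + d) * (w * w) + 2 * (4 + d) * (s * w) + 4 * w
  balance = solve-∀
w-piece d s (suc f) 1 _ _ =
  ≤-by-slack (d * (2 * f + f * f) + (4 + 2 * d) * (s * (1 + f)) + 4 * f) (balance d s f)
  where
  balance : ∀ d s f → 4 * ((1 + f) * s) + 4 * ((1 + f) * (1 + f)) + (4 + d) * 1
                        + (d * (2 * f + f * f) + (4 + 2 * d) * (s * (1 + f)) + 4 * f)
                      ≡ (4 + d) * ((1 + f) * (1 + f)) + 2 * (4 + d) * (s * (1 + f)) + 4 * (1 + f)
  balance = solve-∀
w-piece _ _ zero    1             _        ()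
w-piece _ _ _       (suc (suc _)) (s≤s ()) _

-- As 4⌊n²/4⌋ = n² − (n mod 2), one of the three pieces has to absorb c·(n mod 2).
large-pieces : ∀ d x y z w {eA eZ eW} →
  4 * (x * y) + eA ≤ (x + y) * (x + y) →
  z * 4 + eZ ≤ z * (z + 2 * (x + y + w)) →
  4 * (w * (x + y)) + 4 * (w * w) + (4 + d) * eW ≤ (4 + d) * (w * w) + 2 * (4 + d) * ((x + y) * w) + 4 * w →
  4 * budget (4 + d) x y z w + (4 + d) * (eA + eZ + eW)
    ≤ (4 + d) * ((x + y + z + w) * (x + y + z + w)) + 4 * w + 4 * bonus x y
large-pieces d x y z w {eA} {eZ} {eW} x-piece z-piece′ w-piece′ = begin
  4 * (c * (x * y) + b + w * (x + y) + c * z + w * w) + c * (eA + eZ + eW)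
    ≡⟨ regroup c x y z w b eA eZ eW ⟩
  c * (4 * (x * y) + eA) + c * (z * 4 + eZ) + (4 * (w * (x + y)) + 4 * (w * w) + c * eW) + 4 * b
    ≤⟨ +-monoˡ-≤ (4 * b) (+-mono-≤ (+-mono-≤ (*-monoʳ-≤ c x-piece) (*-monoʳ-≤ c z-piece′)) w-piece′) ⟩
  c * ((x + y) * (x + y)) + c * (z * (z + 2 * (x + y + w)))
    + (c * (w * w) + 2 * c * ((x + y) * w) + 4 * w) + 4 * b
    ≡⟨ collect c x y z w b ⟩
  c * ((x + y + z + w) * (x + y + z + w)) + 4 * w + 4 * b ∎
  where
  open ≤-Reasoning
  c b : ℕ
  c = 4 + d
  b = bonus x y
  regroup : ∀ c x y z w b eA eZ eW →
    4 * (c * (x * y) + b + w * (x + y) + c * z + w * w) + c * (eA + eZ + eW)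
    ≡ c * (4 * (x * y) + eA) + c * (z * 4 + eZ) + (4 * (w * (x + y)) + 4 * (w * w) + c * eW) + 4 * b
  regroup = solve-∀
  collect : ∀ c x y z w b →
    c * ((x + y) * (x + y)) + c * (z * (z + 2 * (x + y + w))) + (c * (w * w) + 2 * c * ((x + y) * w) + 4 * w) + 4 * b
    ≡ c * ((x + y + z + w) * (x + y + z + w)) + 4 * w + 4 * b
  collect = solve-∀

-- With n odd, w = 0 and x = y, the odd part of n sits in z, so z ≥ 3.
odd-z-room : ∀ x z → Odd (x + x + z + 0) → z ≢ 1 → (x + x + z + 0 ≡ 3 → z ≢ 3) →
  1 ≤ z × 5 ≤ z + 2 * (x + x + 0)
odd-z-room x z (q , n≡odd) z≢1 z≢3 with even-or-odd z
... | inj₁ (k , refl) = contradiction (trans (rearrange x k) n≡odd) (even≢odd (x + k) q)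
  where
  rearrange : ∀ x k → 2 * (x + k) ≡ x + x + 2 * k + 0
  rearrange = solve-∀
... | inj₂ (0 , refl) = contradiction refl z≢1
... | inj₂ (1 , refl) with x
...   | 0     = contradiction refl (z≢3 refl)
...   | suc x = s≤s z≤n , ≤-by-slack (2 + 4 * x) (rearrange x)
  where
  rearrange : ∀ x → 5 + (2 + 4 * x) ≡ 3 + 2 * (suc x + suc x + 0)
  rearrange = solve-∀
odd-z-room x z _ _ _ | inj₂ (suc (suc k) , refl) =
  s≤s z≤n , ≤-by-slack (2 * k + 2 * (x + x + 0)) (rearrange k x)
  where
  rearrange : ∀ k x → 5 + (2 * k + 2 * (x + x + 0)) ≡ suc (2 * (2 + k)) + 2 * (x + x + 0)
  rearrange = solve-∀

large-off-diagonal : ∀ d x y z w r → 4 ≤ z + 2 * (x + y + w) → z ≢ 1 →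
  (x + y + z + w ≡ 3 → z ≢ 3) → r ≡ 0 ⊎ (r ≡ 1 × Odd (x + y + z + w)) →
  4 * budget (4 + d) x y z w + (4 + d) * r
    ≤ (4 + d) * ((x + y + z + w) * (x + y + z + w)) + 4 * w + 4 * bonus x y
large-off-diagonal d x y z w _ roomy _ _ (inj₁ refl) = large-pieces d x y z w {0} {0} {0}
  (≤-trans (≤-reflexive (+-identityʳ _)) (amgm x y))
  (≤-trans (≤-reflexive (+-identityʳ _)) (*-monoʳ-≤ z roomy))
  (w-piece d (x + y) w 0 z≤n z≤n)
large-off-diagonal d x y z (suc f) _ roomy _ _ (inj₂ (refl , _)) = large-pieces d x y z (suc f) {0} {0} {1}
  (≤-trans (≤-reflexive (+-identityʳ _)) (amgm x y))
  (≤-trans (≤-reflexive (+-identityʳ _)) (*-monoʳ-≤ z roomy))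
  (w-piece d (x + y) (suc f) 1 ≤-refl (s≤s z≤n))
large-off-diagonal d x y z 0 _ roomy z≢1 z≢3 (inj₂ (refl , odd)) with x ≟ℕ y
... | no x≢y = large-pieces d x y z 0 {1} {0} {0}
  (amgm-strict x≢y)
  (≤-trans (≤-reflexive (+-identityʳ _)) (*-monoʳ-≤ z roomy))
  (w-piece d (x + y) 0 0 z≤n z≤n)
... | yes refl with odd-z-room x z odd z≢1 z≢3
...   | z≥1 , roomier = large-pieces d x x z 0 {0} {1} {0}
  (≤-trans (≤-reflexive (+-identityʳ _)) (amgm x x))
  (z-piece-strict z (x + x + 0) z≥1 roomier)
  (w-piece d (x + x) 0 0 z≤n z≤n)

large-budget≤square-diagonal : ∀ d z w → 3 ≤ 2 + z + w → z ≢ 1 →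
  4 * budget (4 + d) 1 1 z w + (4 + d) * 1 ≤ (4 + d) * ((2 + z + w) * (2 + z + w)) + 4 * w
large-budget≤square-diagonal d z (suc f) _ _ = ≤-by-slack _ (balance d z f)
  where
  balance : ∀ d z f →
    4 * ((4 + d) * 1 + 1 + (1 + f) * 2 + (4 + d) * z + (1 + f) * (1 + f)) + (4 + d) * 1
      + ((4 + d) * (z * z) + 4 + 4 * d + 6 * d * f + d * (f * f) + 12 * f + 2 * (4 + d) * (z * (1 + f)))
    ≡ (4 + d) * ((2 + z + (1 + f)) * (2 + z + (1 + f))) + 4 * (1 + f)
  balance = solve-∀
large-budget≤square-diagonal d (suc (suc g)) zero _ _ = ≤-by-slack _ (balance d g)
  where
  balance : ∀ d g →
    4 * ((4 + d) * 1 + 1 + 0 + (4 + d) * (2 + g) + 0) + (4 + d) * 1 + (8 + 3 * d + (4 + d) * (4 * g + g * g))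
    ≡ (4 + d) * ((2 + (2 + g) + 0) * (2 + (2 + g) + 0)) + 4 * 0
  balance = solve-∀
large-budget≤square-diagonal d 1 zero _ z≢1 = contradiction refl z≢1
large-budget≤square-diagonal d 0 zero (s≤s (s≤s ())) _

large-budget≤square : ∀ d x y z w r → 4 ≤ z + 2 * (x + y + w) → 3 ≤ x + y + z + w → z ≢ 1 →
  (x + y + z + w ≡ 3 → z ≢ 3) → r ≡ 0 ⊎ (r ≡ 1 × Odd (x + y + z + w)) →
  4 * budget (4 + d) x y z w + (4 + d) * r ≤ (4 + d) * ((x + y + z + w) * (x + y + z + w)) + 4 * w
large-budget≤square d x y z w r roomy n≥3 z≢1 z≢3 parity with (x ≟ℕ 1) ×-dec (y ≟ℕ 1)
... | yes (refl , refl) =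
  ≤-trans (+-monoʳ-≤ _ (*-monoʳ-≤ (4 + d) (r≤1 parity))) (large-budget≤square-diagonal d z w n≥3 z≢1)
  where
  r≤1 : ∀ {r} → r ≡ 0 ⊎ (r ≡ 1 × Odd (2 + z + w)) → r ≤ 1
  r≤1 (inj₁ refl)       = z≤n
  r≤1 (inj₂ (refl , _)) = ≤-refl
... | no ¬11 = ≤-trans (large-off-diagonal d x y z w r roomy z≢1 z≢3 parity)
                      (≤-reflexive (trans (cong (λ b → N + 4 * b) (bonus≡0 x y ¬11)) (+-identityʳ N)))
  where
  N : ℕ
  N = (4 + d) * ((x + y + z + w) * (x + y + z + w)) + 4 * w

budget-mono : ∀ {c c′} x y z w → c ≤ c′ → budget c x y z w ≤ budget c′ x y z w
budget-mono x y z w c≤c′ = +-monoˡ-≤ (w * w)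
  (+-mono-≤ (+-monoˡ-≤ (w * (x + y)) (+-monoˡ-≤ (bonus x y) (*-monoˡ-≤ (x * y) c≤c′))) (*-monoˡ-≤ z c≤c′))

[1+k*d]/d≡k : ∀ k d .{{_ : NonZero d}} → 2 ≤ d → (1 + k * d) / d ≡ k
[1+k*d]/d≡k k d@(suc (suc _)) (s≤s (s≤s _)) = trans (+-distrib-/-∣ʳ 1 (divides-refl k)) (m*n/n≡m k d)

quarter-even : ∀ q → 2 * q * (2 * q) / 4 ≡ q * q
quarter-even q = trans (/-congˡ {o = 4} (square q)) (m*n/n≡m (q * q) 4)
  where
  square : ∀ q → 2 * q * (2 * q) ≡ q * q * 4
  square = solve-∀

quarter-odd : ∀ q → suc (2 * q) * suc (2 * q) / 4 ≡ q * q + q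
quarter-odd q = trans (/-congˡ {o = 4} (square q)) ([1+k*d]/d≡k (q * q + q) 4 (s≤s (s≤s z≤n)))
  where
  square : ∀ q → suc (2 * q) * suc (2 * q) ≡ 1 + (q * q + q) * 4
  square = solve-∀

half-even : ∀ q → 2 * q / 2 ≡ q
half-even q = trans (/-congˡ {o = 2} (*-comm 2 q)) (m*n/n≡m q 2)

half-odd : ∀ q → suc (2 * q) / 2 ≡ q
half-odd q = trans (/-congˡ {o = 2} (cong suc (*-comm 2 q))) ([1+k*d]/d≡k q 2 ≤-refl)

square≡4*quarter+parity : ∀ n → ∃[ r ] (r ≡ 0 ⊎ (r ≡ 1 × Odd n)) × n * n ≡ 4 * (n * n / 4) + r
square≡4*quarter+parity n with even-or-odd n
... | inj₁ (q , refl) = 0 , inj₁ refl ,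
  trans (expand q) (cong (λ m → 4 * m + 0) (sym (quarter-even q)))
  where
  expand : ∀ q → 2 * q * (2 * q) ≡ 4 * (q * q) + 0
  expand = solve-∀
... | inj₂ (q , refl) = 1 , inj₂ (refl , q , refl) ,
  trans (expand q) (cong (λ m → 4 * m + 1) (sym (quarter-odd q)))
  where
  expand : ∀ q → suc (2 * q) * suc (2 * q) ≡ 4 * (q * q + q) + 1
  expand = solve-∀

small-budget⇒bound : ∀ c x y z w T → c ≤ 3 → 4 ≤ z + 2 * (x + y + w) → 3 ≤ x + y + z + w → z ≢ 1 →
  T + w ≤ budget c x y z w → T ≤ (x + y + z + w) * (x + y + z + w) ∸ (x + y + z + w)
small-budget⇒bound c x y z w T c≤3 roomy n≥3 z≢1 T+w≤budget = m+n≤o⇒m≤o∸n T (begin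
  T + (x + y + z + w)             ≡⟨ rearrange T x y z w ⟩
  T + w + (x + y + z)             ≤⟨ +-monoˡ-≤ (x + y + z) (≤-trans T+w≤budget (budget-mono x y z w c≤3)) ⟩
  budget 3 x y z w + (x + y + z)  ≤⟨ small-budget≤square x y z w roomy n≥3 z≢1 ⟩
  (x + y + z + w) * (x + y + z + w) ∎)
  where
  open ≤-Reasoning
  rearrange : ∀ T x y z w → T + (x + y + z + w) ≡ T + w + (x + y + z)
  rearrange = solve-∀

large-budget⇒bound : ∀ d x y z w T → 4 ≤ z + 2 * (x + y + w) → 3 ≤ x + y + z + w → z ≢ 1 →
  (x + y + z + w ≡ 3 → z ≢ 3) → T + w ≤ budget (4 + d) x y z w →
  T ≤ (4 + d) * ((x + y + z + w) * (x + y + z + w) / 4)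
large-budget⇒bound d x y z w T roomy n≥3 z≢1 z≢3 T+w≤budget
  with square≡4*quarter+parity (x + y + z + w)
... | r , parity , n²≡ = *-cancelˡ-≤ 4 (+-cancelʳ-≤ (4 * w + c * r) (4 * T) (4 * (c * F)) (begin
  4 * T + (4 * w + c * r)         ≡⟨ regroup T w c r ⟩
  4 * (T + w) + c * r             ≤⟨ +-monoˡ-≤ (c * r) (*-monoʳ-≤ 4 T+w≤budget) ⟩
  4 * budget c x y z w + c * r    ≤⟨ large-budget≤square d x y z w r roomy n≥3 z≢1 z≢3 parity ⟩
  c * (n * n) + 4 * w             ≡⟨ cong (λ m → c * m + 4 * w) n²≡ ⟩
  c * (4 * F + r) + 4 * w         ≡⟨ regroup′ c F r w ⟩
  4 * (c * F) + (4 * w + c * r)   ∎))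
  where
  open ≤-Reasoning
  c n F : ℕ
  c = 4 + d
  n = x + y + z + w
  F = n * n / 4
  regroup : ∀ T w c r → 4 * T + (4 * w + c * r) ≡ 4 * (T + w) + c * r
  regroup = solve-∀
  regroup′ : ∀ c F r w → c * (4 * F + r) + 4 * w ≡ 4 * (c * F) + (4 * w + c * r)
  regroup′ = solve-∀

budget⇒bound : ∀ c x y z w T → 2 ≤ c → 3 ≤ x + y + z + w → z ≢ 1 → (x + y + z + w ≡ 3 → z ≢ 3) →
  T + w ≤ budget c x y z w → T ≤ bound c (x + y + z + w)
budget⇒bound 1 _ _ _ _ _ (s≤s ()) _ _ _
budget⇒bound 2 x y z w T _ n≥3 z≢1 z≢3 =
  small-budget⇒bound 2 x y z w T (s≤s (s≤s z≤n)) (4≤z+2*[x+y+w] x y z w n≥3 z≢3) n≥3 z≢1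
budget⇒bound 3 x y z w T _ n≥3 z≢1 z≢3 =
  small-budget⇒bound 3 x y z w T ≤-refl (4≤z+2*[x+y+w] x y z w n≥3 z≢3) n≥3 z≢1
budget⇒bound (suc (suc (suc (suc d)))) x y z w T _ n≥3 z≢1 z≢3 =
  large-budget⇒bound d x y z w T (4≤z+2*[x+y+w] x y z w n≥3 z≢3) n≥3 z≢1 z≢3

back-edge-budget : ∀ c x y w → 2 ≤ c → 1 ≤ y → (y ≡ 1 → x ≡ 1) → y + w + c ≤ c * y + w + bonus x y
back-edge-budget c x 1 w _ _ x≡1 rewrite x≡1 refl = ≤-reflexive (rearrange c w)
  where
  rearrange : ∀ c w → 1 + w + c ≡ c * 1 + w + 1
  rearrange = solve-∀
back-edge-budget c x (suc (suc y)) w c≥2 _ _ = begin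
  2 + y + w + c       ≡⟨ rearrange (2 + y) w c ⟩
  c + (2 + y) + w     ≤⟨ +-monoˡ-≤ w (+≤* c≥2 (s≤s (s≤s z≤n))) ⟩
  c * (2 + y) + w     ≤⟨ m≤m+n _ _ ⟩
  c * (2 + y) + w + _ ∎
  where
  open ≤-Reasoning
  rearrange : ∀ y w c → y + w + c ≡ c + y + w
  rearrange = solve-∀


-- Heavy edges in a collection without rainbow S₁,₁

reverse : ∀ {c n} → Collection c n → Collection c n
reverse G i u v = G i v u

reverse-loopless : ∀ {c n} (G : Collection c n) → (∀ i → Loopless (G i)) → ∀ i → Loopless (reverse G i)
reverse-loopless G loopless = loopless

reverse-no-rainbow : ∀ {c n} (G : Collection c n) → ¬ RainbowS11 G → ¬ RainbowS11 (reverse G)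
reverse-no-rainbow G no-rainbow (x , y , z , i , j , x≢y , y≢z , x≢z , i≢j , Gᵢzy , Gⱼyx) =
  no-rainbow (z , y , x , j , i , y≢z ∘ sym , x≢y ∘ sym , x≢z ∘ sym , i≢j ∘ sym , Gⱼyx , Gᵢzy)

module HeavyEdges {c n} (G : Collection c n) (loopless : ∀ i → Loopless (G i))
                  (no-rainbow : ¬ RainbowS11 G) where

  mult : Fin n → Fin n → ℕ
  mult u v = sumFin c (λ i → toℕᵇ (G i u v))

  Heavy : Fin n → Fin n → Set
  Heavy u v = 2 ≤ mult u v

  isTail : Fin n → Bool
  isTail u = does (any? (λ v → 2 ≤? mult u v))

  inDeg outDeg : Fin n → ℕ
  inDeg  u = sumFin n (λ v → mult v u)
  outDeg u = sumFin n (λ v → mult u v)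

  degree : Fin n → ℕ
  degree u = inDeg u + outDeg u

  mult≤c : ∀ u v → mult u v ≤ c
  mult≤c u v = begin
    mult u v           ≤⟨ sumFin-mono-≤ c (λ i → toℕᵇ≤1 (G i u v)) ⟩
    sumFin c (λ _ → 1) ≡⟨ sumFin-const c 1 ⟩
    c * 1              ≡⟨ *-identityʳ c ⟩
    c                  ∎
    where open ≤-Reasoning

  mult-diag : ∀ u → mult u u ≡ 0
  mult-diag u = begin
    mult u u           ≡⟨ sumFin-cong c (λ i → cong toℕᵇ (loopless i u)) ⟩
    sumFin c (λ _ → 0) ≡⟨ sumFin-const c 0 ⟩
    c * 0              ≡⟨ *-zeroʳ c ⟩
    0                  ∎
    where open ≡-Reasoning

  heavy⇒distinct : ∀ {u v} → Heavy u v → u ≢ v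
  heavy⇒distinct {u} h refl = contradiction (≤-trans h (≤-reflexive (mult-diag u))) λ ()

  mult>0⇒edge : ∀ {u v} → 0 < mult u v → ∃[ j ] G j u v ≡ true
  mult>0⇒edge {u} {v} pos with sumFin-pos c (λ i → toℕᵇ (G i u v)) pos
  ... | j , Gⱼuv>0 = j , toℕᵇ>0 Gⱼuv>0

  edge⇒distinct : ∀ {j a b} → G j a b ≡ true → a ≢ b
  edge⇒distinct {j} {a} Gⱼab refl = contradiction (trans (sym Gⱼab) (loopless j a)) λ ()

  -- The absence of a rainbow S₁,₁ enters only here: every edge x → v after p → x has its colour.
  mult-after-edge≤1 : ∀ {p x v} → 0 < mult p x → v ≢ p → mult x v ≤ 1
  mult-after-edge≤1 {p} {x} {v} pos v≢p with mult>0⇒edge pos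
  ... | j , Gⱼpx = begin
    mult x v             ≡⟨ sumFin-single c (λ i → toℕᵇ (G i x v)) j others-absent ⟩
    toℕᵇ (G j x v)       ≤⟨ toℕᵇ≤1 (G j x v) ⟩
    1                    ∎
    where
    open ≤-Reasoning
    others-absent : ∀ i → i ≢ j → toℕᵇ (G i x v) ≡ 0
    others-absent i i≢j with G i x v in Gᵢxv
    ... | false = refl
    ... | true  = contradiction
      (p , x , v , j , i , edge⇒distinct Gⱼpx , edge⇒distinct Gᵢxv , v≢p ∘ sym , i≢j ∘ sym , Gⱼpx , Gᵢxv)
      no-rainbow

  mult-into-heavy-source≡0 : ∀ {u p w} → Heavy u p → w ≢ p → mult w u ≡ 0
  mult-into-heavy-source≡0 {u} {p} {w} heavy w≢p with mult w u in m≡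
  ... | zero  = refl
  ... | suc _ = contradiction (≤-trans heavy (mult-after-edge≤1 (subst (0 <_) (sym m≡) (s≤s z≤n)) (w≢p ∘ sym)))
                            (<-irrefl refl)

  isTail-intro : ∀ {u p} → Heavy u p → isTail u ≡ true
  isTail-intro {u} {p} heavy = dec-true (any? (λ v → 2 ≤? mult u v)) (p , heavy)

  isTail-elim : ∀ {u} → isTail u ≡ true → ∃[ p ] Heavy u p
  isTail-elim {u} tail with any? (λ v → 2 ≤? mult u v)
  ... | yes heavy = heavy

  heavy-into-source : ∀ {u p r} → Heavy u p → Heavy r u → r ≡ p
  heavy-into-source {u} {p} {r} heavy heavy-ru with r ≟ p
  ... | yes r≡p = r≡p
  ... | no  r≢p = contradiction (≤-trans heavy-ru (≤-reflexive (mult-into-heavy-source≡0 heavy r≢p))) λ ()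

  inDeg-heavy-source : ∀ {u p} → Heavy u p → inDeg u ≡ mult p u
  inDeg-heavy-source {u} {p} heavy =
    sumFin-single n (λ v → mult v u) p (λ w w≢p → mult-into-heavy-source≡0 heavy w≢p)

  inDeg-tail≤c : ∀ {u} → isTail u ≡ true → inDeg u ≤ c
  inDeg-tail≤c {u} tail with isTail-elim tail
  ... | p , heavy = ≤-trans (≤-reflexive (inDeg-heavy-source heavy)) (mult≤c p u)

module Classes {c n} (G : Collection c n) (loopless : ∀ i → Loopless (G i))
               (no-rainbow : ¬ RainbowS11 G) where

  open HeavyEdges G loopless no-rainbow public
  private
    module R = HeavyEdges (reverse G) (reverse-loopless G loopless) (reverse-no-rainbow G no-rainbow)

  isHead : Fin n → Bool
  isHead = R.isTail

  inX inY inZ inW : Fin n → Bool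
  inX u = isTail u ∧ not (isHead u)
  inY u = not (isTail u) ∧ isHead u
  inZ u = isTail u ∧ isHead u
  inW u = not (isTail u) ∧ not (isHead u)

  X Y Z W : ℕ
  X = count inX
  Y = count inY
  Z = count inZ
  W = count inW

  inX-elim : ∀ {u} → inX u ≡ true → isTail u ≡ true × isHead u ≡ false
  inX-elim u∈X = ∧-conicalˡ _ _ u∈X , not-injective (∧-conicalʳ _ _ u∈X)

  inZ-elim : ∀ {u} → inZ u ≡ true → isTail u ≡ true × isHead u ≡ true
  inZ-elim u∈Z = ∧-conicalˡ _ _ u∈Z , ∧-conicalʳ _ _ u∈Z

  inW-elim : ∀ {u} → inW u ≡ true → isTail u ≡ false × isHead u ≡ false
  inW-elim u∈W = not-injective (∧-conicalˡ _ _ u∈W) , not-injective (∧-conicalʳ _ _ u∈W)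

  isHead-intro : ∀ {q u} → Heavy q u → isHead u ≡ true
  isHead-intro = R.isTail-intro

  isHead-elim : ∀ {u} → isHead u ≡ true → ∃[ q ] Heavy q u
  isHead-elim = R.isTail-elim

  mult-out-of-heavy-target≡0 : ∀ {q v w} → Heavy q v → w ≢ q → mult v w ≡ 0
  mult-out-of-heavy-target≡0 = R.mult-into-heavy-source≡0

  mult-into-nonhead≤1 : ∀ {u} → isHead u ≡ false → ∀ v → mult v u ≤ 1
  mult-into-nonhead≤1 {u} ¬head v with mult v u ≤? 1
  ... | yes m≤1 = m≤1
  ... | no  m≰1 = contradiction (trans (sym (isHead-intro (≰⇒> m≰1))) ¬head) λ ()

  mult-nonhead-to-tail≡0 : ∀ {u v} → isHead u ≡ false → isTail v ≡ true → mult u v ≡ 0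
  mult-nonhead-to-tail≡0 {u} {v} ¬head tail with isTail-elim tail
  ... | q , heavy with u ≟ q
  ...   | no  u≢q  = mult-into-heavy-source≡0 heavy u≢q
  ...   | yes refl = contradiction (trans (sym (isHead-intro heavy)) ¬head) λ ()

  heavy-from-nonhead⇒¬tail : ∀ {u p} → isHead u ≡ false → Heavy u p → isTail p ≡ false
  heavy-from-nonhead⇒¬tail {u} {p} ¬head heavy with isTail p in tail
  ... | false = refl
  ... | true  = contradiction (≤-trans heavy (≤-reflexive (mult-nonhead-to-tail≡0 ¬head tail))) λ ()

  heavy-from-head⇒heavy-back : ∀ {u p} → isHead u ≡ true → Heavy u p → Heavy p u
  heavy-from-head⇒heavy-back {u} {p} head heavy with isHead-elim head
  ... | q , heavy-in with heavy-into-source heavy heavy-in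
  ...   | refl = heavy-in

  heavy-avoids-heavy-pair : ∀ {u p r s} → isHead u ≡ true → Heavy u p → Heavy r s →
    r ≢ u → r ≢ p → s ≢ u × s ≢ p
  heavy-avoids-heavy-pair head heavy heavy-rs r≢u r≢p =
    (λ { refl → r≢p (heavy-into-source heavy heavy-rs) }) ,
    (λ { refl → r≢u (heavy-into-source (heavy-from-head⇒heavy-back head heavy) heavy-rs) })

  inDeg-isolated : ∀ {u} → isTail u ≡ false → isHead u ≡ false → inDeg u + 1 ≤ count (not ∘ isHead)
  inDeg-isolated {u} ¬tail ¬head = subst₂ _≤_
    (cong (λ h → inDeg u + toℕᵇ (not h)) ¬head)
    (trans (cong (count (not ∘ isHead) +_) (mult-diag u)) (+-identityʳ _))
    (sumFin-mono-except n (λ v → mult v u) (toℕᵇ ∘ not ∘ isHead) u bounded)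
    where
    bounded : ∀ v → v ≢ u → mult v u ≤ toℕᵇ (not (isHead v))
    bounded v v≢u with isHead v in head
    ... | false = mult-into-nonhead≤1 ¬head v
    ... | true  with isHead-elim head
    ...   | q , heavy with u ≟ q
    ...     | no  u≢q  = ≤-reflexive (mult-out-of-heavy-target≡0 heavy u≢q)
    ...     | yes refl = contradiction (trans (sym (isTail-intro heavy)) ¬tail) λ ()

  count-by-class : (F : Bool → Bool → ℕ) →
    sumFin n (λ u → F (isTail u) (isHead u)) ≡ X * F true false + Y * F false true + Z * F true true + W * F false false
  count-by-class = sumFin-by-classes n isTail isHead

  count-¬tail : count (not ∘ isTail) ≡ Y + W
  count-¬tail = trans (count-by-class (λ t _ → toℕᵇ (not t))) (normalise X Y Z W)
    where
    normalise : ∀ X Y Z W → X * 0 + Y * 1 + Z * 0 + W * 1 ≡ Y + W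
    normalise = solve-∀

  count-¬head : count (not ∘ isHead) ≡ X + W
  count-¬head = trans (count-by-class (λ _ h → toℕᵇ (not h))) (normalise X Y Z W)
    where
    normalise : ∀ X Y Z W → X * 1 + Y * 0 + Z * 0 + W * 1 ≡ X + W
    normalise = solve-∀

  n≡X+Y+Z+W : n ≡ X + Y + Z + W
  n≡X+Y+Z+W = begin
    n                  ≡⟨ *-identityʳ n ⟨
    n * 1              ≡⟨ sumFin-const n 1 ⟨
    sumFin n (λ _ → 1) ≡⟨ count-by-class (λ _ _ → 1) ⟩
    X * 1 + Y * 1 + Z * 1 + W * 1 ≡⟨ normalise X Y Z W ⟩
    X + Y + Z + W      ∎
    where
    open ≡-Reasoning
    normalise : ∀ X Y Z W → X * 1 + Y * 1 + Z * 1 + W * 1 ≡ X + Y + Z + W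
    normalise = solve-∀

  outDeg-nonhead : ∀ {u} → isHead u ≡ false → outDeg u ≤ c * Y + W
  outDeg-nonhead {u} ¬head = begin
    outDeg u                                 ≤⟨ sumFin-mono-≤ n (λ v → bounded (isTail v) (isHead v) refl refl) ⟩
    sumFin n (λ v → cap (isTail v) (isHead v)) ≡⟨ count-by-class cap ⟩
    X * 0 + Y * c + Z * 0 + W * 1            ≡⟨ normalise X Y Z W c ⟩
    c * Y + W                                ∎
    where
    open ≤-Reasoning
    cap : Bool → Bool → ℕ
    cap true  _     = 0
    cap false true  = c
    cap false false = 1
    bounded : ∀ {v} t h → isTail v ≡ t → isHead v ≡ h → mult u v ≤ cap t h
    bounded {v} true  _     tail  _     = ≤-reflexive (mult-nonhead-to-tail≡0 ¬head tail)
    bounded {v} false true  _     _     = mult≤c u v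
    bounded {v} false false _     ¬head' = mult-into-nonhead≤1 ¬head' u
    normalise : ∀ X Y Z W c → X * 0 + Y * c + Z * 0 + W * 1 ≡ c * Y + W
    normalise = solve-∀

  outDeg-back-edge : ∀ {u p} → isHead u ≡ false → isTail p ≡ false → 0 < mult p u → outDeg u + 1 ≤ Y + W + c
  outDeg-back-edge {u} {p} ¬head ¬tail back = begin
    outDeg u + 1                    ≡⟨ cong (λ t → outDeg u + toℕᵇ (not t)) ¬tail ⟨
    outDeg u + toℕᵇ (not (isTail p)) ≤⟨ sumFin-mono-except n (mult u) (toℕᵇ ∘ not ∘ isTail) p bounded ⟩
    count (not ∘ isTail) + mult u p ≤⟨ +-mono-≤ (≤-reflexive count-¬tail) (mult≤c u p) ⟩
    Y + W + c                       ∎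
    where
    open ≤-Reasoning
    bounded : ∀ v → v ≢ p → mult u v ≤ toℕᵇ (not (isTail v))
    bounded v v≢p with isTail v in tail
    ... | true  = ≤-reflexive (mult-nonhead-to-tail≡0 ¬head tail)
    ... | false = mult-after-edge≤1 back v≢p

  heavy-target-in-Y : ∀ {u p} → isHead u ≡ false → Heavy u p → inY p ≡ true
  heavy-target-in-Y ¬head heavy =
    cong₂ (λ t h → not t ∧ h) (heavy-from-nonhead⇒¬tail ¬head heavy) (isHead-intro heavy)

  -- Two X-vertices with heavy edges into the same p would leave no room for a back edge p → u.
  Y≡1⇒X≡1 : ∀ {u p} → inX u ≡ true → Heavy u p → 0 < mult p u → Y ≡ 1 → X ≡ 1
  Y≡1⇒X≡1 {u} {p} u∈X heavy back Y≡1 = count-single inX u∈X only-u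
    where
    only-u : ∀ v → inX v ≡ true → v ≡ u
    only-u v v∈X with inX-elim v∈X
    ... | v-tail , v-¬head with isTail-elim v-tail
    ... | q , heavy-vq
      with count≡1⇒unique inY Y≡1 (heavy-target-in-Y v-¬head heavy-vq)
                                  (heavy-target-in-Y (proj₂ (inX-elim u∈X)) heavy)
    ...   | refl with u ≟ v
    ...     | yes u≡v = sym u≡v
    ...     | no  u≢v = contradiction (mult-out-of-heavy-target≡0 heavy-vq u≢v) (>⇒≢ back)

  degree-without-back-edge : ∀ {u p} → isHead u ≡ false → Heavy u p → mult p u ≡ 0 → degree u ≤ c * Y + W
  degree-without-back-edge {u} {p} ¬head heavy no-back = begin
    inDeg u + outDeg u ≡⟨ cong (_+ outDeg u) (trans (inDeg-heavy-source heavy) no-back) ⟩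
    outDeg u           ≤⟨ outDeg-nonhead ¬head ⟩
    c * Y + W          ∎
    where open ≤-Reasoning

  degree-with-back-edge : ∀ {u p} → isHead u ≡ false → Heavy u p → 0 < mult p u → degree u ≤ Y + W + c
  degree-with-back-edge {u} {p} ¬head heavy back = +-cancelʳ-≤ 1 _ _ (begin
    inDeg u + outDeg u + 1   ≡⟨ +-assoc (inDeg u) (outDeg u) 1 ⟩
    inDeg u + (outDeg u + 1) ≤⟨ +-mono-≤ inDeg≤1 (outDeg-back-edge ¬head (heavy-from-nonhead⇒¬tail ¬head heavy) back) ⟩
    1 + (Y + W + c)          ≡⟨ +-comm 1 _ ⟩
    Y + W + c + 1            ∎)
    where
    open ≤-Reasoning
    inDeg≤1 : inDeg u ≤ 1
    inDeg≤1 = ≤-trans (≤-reflexive (inDeg-heavy-source heavy)) (mult-into-nonhead≤1 ¬head p)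

  degree-X : 2 ≤ c → ∀ {u} → inX u ≡ true → degree u ≤ c * Y + W + bonus X Y
  degree-X c≥2 {u} u∈X with inX-elim u∈X
  ... | tail , ¬head with isTail-elim tail
  ...   | p , heavy with mult p u in back≡
  ...     | zero  = ≤-trans (degree-without-back-edge ¬head heavy back≡) (m≤m+n _ _)
  ...     | suc _ = ≤-trans (degree-with-back-edge ¬head heavy back)
                            (back-edge-budget c X Y W c≥2 (count-pos inY (heavy-target-in-Y ¬head heavy))
                                                           (Y≡1⇒X≡1 u∈X heavy back))
    where
    back : 0 < mult p u
    back = subst (0 <_) (sym back≡) (s≤s z≤n)

  Z≢1 : Z ≢ 1
  Z≢1 Z≡1 with count-pos⇒∃ inZ (≤-reflexive (sym Z≡1))
  ... | u , u∈Z with inZ-elim u∈Z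
  ...   | tail , head with isTail-elim tail
  ...     | p , heavy = heavy⇒distinct heavy (count≡1⇒unique inZ Z≡1 u∈Z p∈Z)
    where
    p∈Z : inZ p ≡ true
    p∈Z = cong₂ _∧_ (isTail-intro (heavy-from-head⇒heavy-back head heavy)) (isHead-intro heavy)

  -- On three vertices a heavy 2-cycle leaves a third vertex whose heavy edge has nowhere to go.
  Z≢3 : n ≡ 3 → Z ≢ 3
  Z≢3 refl Z≡3 = no-heavy-edge-from-0 (isTail-elim (tail zero))
    where
    tail : ∀ u → isTail u ≡ true
    tail u = proj₁ (inZ-elim (count≡k⇒all inZ Z≡3 u))
    head : ∀ u → isHead u ≡ true
    head u = proj₂ (inZ-elim (count≡k⇒all inZ Z≡3 u))
    third : ∀ {p} → Heavy zero p → ∀ r → r ≢ zero → r ≢ p → (∀ s → s ≡ zero ⊎ s ≡ p ⊎ s ≡ r) → ⊥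
    third heavy r r≢0 r≢p cover with isTail-elim (tail r)
    ... | s , heavy-rs with heavy-avoids-heavy-pair (head zero) heavy heavy-rs r≢0 r≢p | cover s
    ...   | s≢0 , _   | inj₁ s≡0         = s≢0 s≡0
    ...   | _   , s≢p | inj₂ (inj₁ s≡p)  = s≢p s≡p
    ...   | _         | inj₂ (inj₂ refl) = heavy⇒distinct heavy-rs refl
    no-heavy-edge-from-0 : ∃[ p ] Heavy zero p → ⊥
    no-heavy-edge-from-0 (zero , heavy)           = heavy⇒distinct heavy refl
    no-heavy-edge-from-0 (suc zero , heavy)       = third heavy (suc (suc zero)) (λ ()) (λ ())
      λ { zero → inj₁ refl ; (suc zero) → inj₂ (inj₁ refl) ; (suc (suc zero)) → inj₂ (inj₂ refl) }
    no-heavy-edge-from-0 (suc (suc zero) , heavy) = third heavy (suc zero) (λ ()) (λ ())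
      λ { zero → inj₁ refl ; (suc zero) → inj₂ (inj₂ refl) ; (suc (suc zero)) → inj₂ (inj₁ refl) }

module DegreeSum {c n} (G : Collection c n) (loopless : ∀ i → Loopless (G i))
                 (no-rainbow : ¬ RainbowS11 G) where

  open Classes G loopless no-rainbow public
  private
    module R = Classes (reverse G) (reverse-loopless G loopless) (reverse-no-rainbow G no-rainbow)

  reverse-X : R.X ≡ Y
  reverse-X = sumFin-cong n (λ u → cong toℕᵇ (∧-comm (isHead u) (not (isTail u))))

  reverse-Y : R.Y ≡ X
  reverse-Y = sumFin-cong n (λ u → cong toℕᵇ (∧-comm (not (isHead u)) (isTail u)))

  reverse-W : R.W ≡ W
  reverse-W = sumFin-cong n (λ u → cong toℕᵇ (∧-comm (not (isHead u)) (not (isTail u))))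

  degree-Y : 2 ≤ c → ∀ {u} → inY u ≡ true → degree u ≤ c * X + W + bonus X Y
  degree-Y c≥2 {u} u∈Y = begin
    inDeg u + outDeg u             ≡⟨ +-comm (inDeg u) (outDeg u) ⟩
    outDeg u + inDeg u             ≤⟨ R.degree-X c≥2 (trans (∧-comm (isHead u) (not (isTail u))) u∈Y) ⟩
    c * R.Y + R.W + bonus R.X R.Y  ≡⟨ cong₂ (λ y w → c * y + w + bonus R.X R.Y) reverse-Y reverse-W ⟩
    c * X + W + bonus R.X R.Y      ≡⟨ cong (c * X + W +_) (trans (cong₂ bonus reverse-X reverse-Y) (bonus-comm Y X)) ⟩
    c * X + W + bonus X Y          ∎
    where open ≤-Reasoning

  degree-Z : ∀ {u} → inZ u ≡ true → degree u ≤ c + c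
  degree-Z u∈Z = +-mono-≤ (inDeg-tail≤c (proj₁ (inZ-elim u∈Z))) (R.inDeg-tail≤c (proj₂ (inZ-elim u∈Z)))

  degree-W : ∀ {u} → inW u ≡ true → degree u + 2 ≤ X + Y + W + W
  degree-W {u} u∈W with inW-elim u∈W
  ... | ¬tail , ¬head = begin
    inDeg u + outDeg u + 2                 ≡⟨ rearrange (inDeg u) (outDeg u) ⟩
    (inDeg u + 1) + (outDeg u + 1)         ≤⟨ +-mono-≤ (inDeg-isolated ¬tail ¬head) (R.inDeg-isolated ¬head ¬tail) ⟩
    count (not ∘ isHead) + count (not ∘ isTail) ≡⟨ cong₂ _+_ count-¬head count-¬tail ⟩
    X + W + (Y + W)                        ≡⟨ rearrange′ X Y W ⟩
    X + Y + W + W                          ∎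
    where
    open ≤-Reasoning
    rearrange : ∀ a b → a + b + 2 ≡ (a + 1) + (b + 1)
    rearrange = solve-∀
    rearrange′ : ∀ x y w → x + w + (y + w) ≡ x + y + w + w
    rearrange′ = solve-∀

  vertex-budget : Bool → Bool → ℕ
  vertex-budget true  false = c * Y + W + bonus X Y
  vertex-budget false true  = c * X + W + bonus X Y
  vertex-budget true  true  = c + c
  vertex-budget false false = X + Y + W + W

  isolation-slack : Bool → Bool → ℕ
  isolation-slack false false = 2
  isolation-slack _     _     = 0

  degree≤vertex-budget : 2 ≤ c → ∀ u →
    degree u + isolation-slack (isTail u) (isHead u) ≤ vertex-budget (isTail u) (isHead u)
  degree≤vertex-budget c≥2 u with isTail u in tail | isHead u in head
  ... | true  | false = ≤-trans (≤-reflexive (+-identityʳ _)) (degree-X c≥2 (cong₂ (λ t h → t ∧ not h) tail head))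
  ... | false | true  = ≤-trans (≤-reflexive (+-identityʳ _)) (degree-Y c≥2 (cong₂ (λ t h → not t ∧ h) tail head))
  ... | true  | true  = ≤-trans (≤-reflexive (+-identityʳ _)) (degree-Z (cong₂ _∧_ tail head))
  ... | false | false = degree-W (cong₂ (λ t h → not t ∧ not h) tail head)

  sum-outDeg : sumFin n outDeg ≡ totalEdges G
  sum-outDeg = sym (trans (sumFin-comm c n (λ i u → sumFin n (λ v → toℕᵇ (G i u v))))
                          (sumFin-cong n (λ u → sumFin-comm c n (λ i v → toℕᵇ (G i u v)))))

  sum-degree : sumFin n degree ≡ 2 * totalEdges G
  sum-degree = begin
    sumFin n degree                    ≡⟨ sumFin-distrib-+ n inDeg outDeg ⟩
    sumFin n inDeg + sumFin n outDeg   ≡⟨ cong (_+ sumFin n outDeg) (sumFin-comm n n (λ u v → mult v u)) ⟩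
    sumFin n outDeg + sumFin n outDeg  ≡⟨ cong₂ _+_ sum-outDeg (trans sum-outDeg (sym (+-identityʳ _))) ⟩
    2 * totalEdges G                   ∎
    where open ≡-Reasoning

  sum-vertex-budget : sumFin n (λ u → vertex-budget (isTail u) (isHead u)) ≡ 2 * budget c X Y Z W
  sum-vertex-budget = begin
    sumFin n (λ u → vertex-budget (isTail u) (isHead u)) ≡⟨ count-by-class vertex-budget ⟩
    X * (c * Y + W + b) + Y * (c * X + W + b) + Z * (c + c) + W * (X + Y + W + W)
      ≡⟨ expand c X Y Z W b ⟩
    2 * (c * (X * Y) + W * (X + Y) + c * Z + W * W) + (X + Y) * b
      ≡⟨ cong (2 * (c * (X * Y) + W * (X + Y) + c * Z + W * W) +_) (bonus-weight X Y) ⟩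
    2 * (c * (X * Y) + W * (X + Y) + c * Z + W * W) + 2 * b
      ≡⟨ collect c X Y Z W b ⟩
    2 * budget c X Y Z W ∎
    where
    open ≡-Reasoning
    b : ℕ
    b = bonus X Y
    expand : ∀ c X Y Z W b → X * (c * Y + W + b) + Y * (c * X + W + b) + Z * (c + c) + W * (X + Y + W + W)
                             ≡ 2 * (c * (X * Y) + W * (X + Y) + c * Z + W * W) + (X + Y) * b
    expand = solve-∀
    collect : ∀ c X Y Z W b → 2 * (c * (X * Y) + W * (X + Y) + c * Z + W * W) + 2 * b
                              ≡ 2 * (c * (X * Y) + b + W * (X + Y) + c * Z + W * W)
    collect = solve-∀

  sum-isolation-slack : sumFin n (λ u → isolation-slack (isTail u) (isHead u)) ≡ 2 * W
  sum-isolation-slack = trans (count-by-class isolation-slack) (normalise X Y Z W)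
    where
    normalise : ∀ X Y Z W → X * 0 + Y * 0 + Z * 0 + W * 2 ≡ 2 * W
    normalise = solve-∀

  edges+W≤budget : 2 ≤ c → totalEdges G + W ≤ budget c X Y Z W
  edges+W≤budget c≥2 = *-cancelˡ-≤ 2 (begin
    2 * (totalEdges G + W)        ≡⟨ *-distribˡ-+ 2 (totalEdges G) W ⟩
    2 * totalEdges G + 2 * W      ≡⟨ cong₂ _+_ sum-degree sum-isolation-slack ⟨
    sumFin n degree + sumFin n (λ u → isolation-slack (isTail u) (isHead u))
                                  ≡⟨ sumFin-distrib-+ n _ _ ⟨
    sumFin n (λ u → degree u + isolation-slack (isTail u) (isHead u))
                                  ≤⟨ sumFin-mono-≤ n (degree≤vertex-budget c≥2) ⟩
    sumFin n (λ u → vertex-budget (isTail u) (isHead u))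
                                  ≡⟨ sum-vertex-budget ⟩
    2 * budget c X Y Z W          ∎)
    where open ≤-Reasoning

-- Extremal constructions

complete-in-first-colour : ∀ {c n} → Collection (suc c) n
complete-in-first-colour zero    u v = not (does (u ≟ v))
complete-in-first-colour (suc _) _ _ = false

complete-loopless : ∀ {c n} i → Loopless (complete-in-first-colour {c} {n} i)
complete-loopless zero    v = cong not (dec-true (v ≟ v) refl)
complete-loopless (suc _) v = refl

complete-no-rainbow : ∀ {c n} → ¬ RainbowS11 (complete-in-first-colour {c} {n})
complete-no-rainbow (_ , _ , _ , zero  , zero  , _ , _ , _ , i≢j , _ , _) = i≢j refl
complete-no-rainbow (_ , _ , _ , suc _ , _     , _ , _ , _ , _   , () , _)
complete-no-rainbow (_ , _ , _ , zero  , suc _ , _ , _ , _ , _   , _ , ())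

complete-edges : ∀ {c n} → totalEdges (complete-in-first-colour {c} {n}) ≡ n * n ∸ n
complete-edges {c} {n} = begin
  edges (complete-in-first-colour {c} {n} zero) + sumFin c (λ _ → sumFin n (λ _ → sumFin n (λ _ → 0)))
    ≡⟨ cong₂ _+_ (sumFin-cong n out-degree) (sumFin-cong c (λ _ → sumFin-cong n (λ _ → zeros n))) ⟩
  sumFin n (λ _ → n ∸ 1) + sumFin c (λ _ → sumFin n (λ _ → 0))
    ≡⟨ cong₂ _+_ (sumFin-const n (n ∸ 1)) (sumFin-cong c (λ _ → zeros n)) ⟩
  n * (n ∸ 1) + sumFin c (λ _ → 0)
    ≡⟨ cong (n * (n ∸ 1) +_) (zeros c) ⟩
  n * (n ∸ 1) + 0
    ≡⟨ +-identityʳ _ ⟩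
  n * (n ∸ 1)
    ≡⟨ *-distribˡ-∸ n n 1 ⟩
  n * n ∸ n * 1
    ≡⟨ cong (n * n ∸_) (*-identityʳ n) ⟩
  n * n ∸ n ∎
  where
  open ≡-Reasoning
  zeros : ∀ k → sumFin k (λ _ → 0) ≡ 0
  zeros k = trans (sumFin-const k 0) (*-zeroʳ k)
  equal-to : Fin n → Fin n → Bool
  equal-to u v = does (u ≟ v)
  out-degree : ∀ u → count (not ∘ equal-to u) ≡ n ∸ 1
  out-degree u = trans (count-not (equal-to u)) (cong (n ∸_) single)
    where
    single : count (equal-to u) ≡ 1
    single = count-single (equal-to u) (dec-true (u ≟ u) refl) only-u
      where
      only-u : ∀ v → equal-to u v ≡ true → v ≡ u
      only-u v u≟v with u ≟ v
      ... | yes u≡v = sym u≡v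
      ... | no  _   = contradiction u≟v λ ()

bipartite : ∀ {c n} → ℕ → Collection c n
bipartite h _ u v = (toℕ u <ᵇ h) ∧ not (toℕ v <ᵇ h)

bipartite-loopless : ∀ {c n} h i → Loopless (bipartite {c} {n} h i)
bipartite-loopless h _ v = ∧-inverseʳ (toℕ v <ᵇ h)

bipartite-no-rainbow : ∀ {c n} h → ¬ RainbowS11 (bipartite {c} {n} h)
bipartite-no-rainbow h (x , y , z , _ , _ , _ , _ , _ , _ , into-y , out-of-y) = contradiction
  (trans (sym (cong not (∧-conicalˡ (toℕ y <ᵇ h) _ out-of-y))) (∧-conicalʳ (toℕ x <ᵇ h) _ into-y)) λ ()

count-below : ∀ n h → h ≤ n → count {n} (λ u → toℕ u <ᵇ h) ≡ h
count-below n       zero    _         = trans (sumFin-const n 0) (*-zeroʳ n)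
count-below (suc n) (suc h) (s≤s h≤n) = cong suc (count-below n h h≤n)

bipartite-edges : ∀ {c n} h → h ≤ n → ∀ i → edges (bipartite {c} {n} h i) ≡ h * (n ∸ h)
bipartite-edges {n = n} h h≤n i = begin
  sumFin n (λ u → sumFin n (λ v → toℕᵇ (A u ∧ not (A v))))   ≡⟨ sumFin-cong n (λ u → sumFin-cong n (λ v → toℕᵇ-∧ (A u) _)) ⟩
  sumFin n (λ u → sumFin n (λ v → toℕᵇ (A u) * toℕᵇ (not (A v)))) ≡⟨ sumFin-cong n (λ u → sumFin-*ˡ n (toℕᵇ (A u)) _) ⟩
  sumFin n (λ u → toℕᵇ (A u) * count (not ∘ A))              ≡⟨ sumFin-*ʳ n _ (toℕᵇ ∘ A) ⟩
  count A * count (not ∘ A)                                  ≡⟨ cong₂ _*_ below (trans (count-not A) (cong (n ∸_) below)) ⟩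
  h * (n ∸ h)                                                ∎
  where
  open ≡-Reasoning
  A : Fin n → Bool
  A u = toℕ u <ᵇ h
  below : count A ≡ h
  below = count-below n h h≤n
  toℕᵇ-∧ : ∀ a b → toℕᵇ (a ∧ b) ≡ toℕᵇ a * toℕᵇ b
  toℕᵇ-∧ true  b = sym (+-identityʳ _)
  toℕᵇ-∧ false b = refl

half*rest≡quarter-square : ∀ n → n / 2 * (n ∸ n / 2) ≡ n * n / 4
half*rest≡quarter-square n with even-or-odd n
... | inj₁ (q , refl) = begin
  2 * q / 2 * (2 * q ∸ 2 * q / 2) ≡⟨ cong (λ h → h * (2 * q ∸ h)) (half-even q) ⟩
  q * (2 * q ∸ q)                 ≡⟨ cong (λ m → q * (m ∸ q)) (+-comm q (q + 0)) ⟩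
  q * (q + 0 + q ∸ q)             ≡⟨ cong (q *_) (trans (m+n∸n≡m (q + 0) q) (+-identityʳ q)) ⟩
  q * q                           ≡⟨ quarter-even q ⟨
  2 * q * (2 * q) / 4             ∎
  where open ≡-Reasoning
... | inj₂ (q , refl) = begin
  suc (2 * q) / 2 * (suc (2 * q) ∸ suc (2 * q) / 2) ≡⟨ cong (λ h → h * (suc (2 * q) ∸ h)) (half-odd q) ⟩
  q * (suc (2 * q) ∸ q)                             ≡⟨ cong (λ m → q * (m ∸ q)) (rearrange q) ⟩
  q * (suc q + q ∸ q)                               ≡⟨ cong (q *_) (m+n∸n≡m (suc q) q) ⟩
  q * suc q                                         ≡⟨ *-suc q q ⟩
  q + q * q                                         ≡⟨ +-comm q (q * q) ⟩
  q * q + q                                         ≡⟨ quarter-odd q ⟨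
  suc (2 * q) * suc (2 * q) / 4                     ∎
  where
  open ≡-Reasoning
  rearrange : ∀ q → suc (2 * q) ≡ suc q + q
  rearrange = solve-∀

-- The bounds and their sharpness

edges≤bound : ∀ {c n} → 2 ≤ c → 3 ≤ n → (G : Collection c n) → (∀ i → Loopless (G i)) → ¬ RainbowS11 G →
  totalEdges G ≤ bound c n
edges≤bound {c} {n} c≥2 n≥3 G loopless no-rainbow = subst (λ m → totalEdges G ≤ bound c m) (sym n≡X+Y+Z+W)
  (budget⇒bound c X Y Z W (totalEdges G) c≥2 (subst (3 ≤_) n≡X+Y+Z+W n≥3) Z≢1
                (Z≢3 ∘ trans n≡X+Y+Z+W) (edges+W≤budget c≥2))
  where open DegreeSum G loopless no-rainbow

extremal : ∀ c n → 2 ≤ c →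
  Σ[ G ∈ Collection c n ] ((∀ i → Loopless (G i)) × ¬ RainbowS11 G × totalEdges G ≡ bound c n)
extremal 1 _ (s≤s ())
extremal 2 n _ = complete-in-first-colour , complete-loopless , complete-no-rainbow , complete-edges {1} {n}
extremal 3 n _ = complete-in-first-colour , complete-loopless , complete-no-rainbow , complete-edges {2} {n}
extremal c@(suc (suc (suc (suc _)))) n _ =
  bipartite (n / 2) , bipartite-loopless (n / 2) , bipartite-no-rainbow (n / 2) , (begin
    sumFin c (λ i → edges (bipartite {c} {n} (n / 2) i)) ≡⟨ sumFin-cong c (bipartite-edges (n / 2) (m/n≤m n 2)) ⟩
    sumFin c (λ _ → n / 2 * (n ∸ n / 2))                 ≡⟨ sumFin-const c (n / 2 * (n ∸ n / 2)) ⟩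
    c * (n / 2 * (n ∸ n / 2))                            ≡⟨ cong (c *_) (half*rest≡quarter-square n) ⟩
    c * (n * n / 4)                                      ∎)
  where open ≡-Reasoning

theorem5 : (c n : ℕ) → c ≥ 2 → n ≥ 3 →
    ((G : Collection c n) → ((i : Fin c) → Loopless (G i)) → ¬ RainbowS11 G →
      totalEdges G ≤ bound c n)
    × (Σ[ G ∈ Collection c n ] (((i : Fin c) → Loopless (G i)) × ¬ RainbowS11 G
      × totalEdges G ≡ bound c n))
theorem5 c n c≥2 n≥3 = edges≤bound c≥2 n≥3 , extremal c n c≥2
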